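{- Let $p_1\neq p_2$ be primes and $\kappa$ an infinite cardinal. Suppose $G,H_1,H_2\in K_2(\kappa)$ with $G\leq_{\mathbf{K}_2}H_1$ and $G\leq_{\mathbf{K}_2}H_2$, $a_1\in H_1$, $a_2\in H_2$, and $p_2^\omega H_1\subseteq G$, $p_2^\omega H_2\subseteq G$. Then $\mathbf{gtp}_{\mathbf{K}_{TF}}(a_1/G;H_1)=\mathbf{gtp}_{\mathbf{K}_{TF}}(a_2/G;H_2)$ if and only if $\mathbf{gtp}_{\mathbf{K}_2(\kappa)}(a_1/G;H_1)=\mathbf{gtp}_{\mathbf{K}_2(\kappa)}(a_2/G;H_2)$.
   Context: For a prime $p$ and group $G$, $p^\omega G:=\bigcap_{n<\omega}p^nG$; $\leq_p$ denotes pure subgroup. $\mathbf{K}_{TF}=(TF,\leq_p)$ is the class of torsion-free abelian groups with pure subgroups. $\mathbf{K}_2(\kappa)=(K_2(\kappa),\leq_{\mathbf{K}_2})$: $K_2(\kappa)$ is the class of torsion-free abelian $G$ with $|p_1^\omega G|,|p_2^\omega G|\le\kappa$; $G_1\leq_{\mathbf{K}_2}G_2$ iff $G_1\leq_pG_2$, $p_1^\omega G_1=p_1^\omega G_2$, and either $p_2^\omega G_1=p_1^\omega G_1$ or $p_2^\omega G_1=p_2^\omega G_2$. For a class $\mathbf{K}=(K,\leq_\mathbf{K})$: a $\mathbf{K}$-embedding $f:M\to N$ is an isomorphism onto $f[M]$ with $f[M]\leq_\mathbf{K}N$; $(b_1,A,N_1)E_{at}(b_2,A,N_2)$ if there are $N\in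 K$ and $\mathbf{K}$-embeddings $f_i:N_i\to N$ fixing $A$ pointwise with $f_1(b_1)=f_2(b_2)$; $E$ is its transitive closure; the Galois type $\mathbf{gtp}_\mathbf{K}(b/A;N)$ is the $E$-class of $(b,A,N)$. -}

module Defs where

open import Level using (0ℓ)
open import Algebra.Bundles using (AbelianGroup)
open import Data.Nat using (ℕ; zero; suc; _^_)
open import Data.Nat.Primality using (Prime)
open import Data.Product using (Σ; _×_; _,_; ∃)
open import Data.Sum using (_⊎_)
open import Relation.Binary.PropositionalEquality using (_≡_; _≢_)
open import Relation.Binary.Construct.Closure.Transitive using (TransClosure)

Grp : Set₁
Grp = AbelianGroup 0ℓ 0ℓ

Car : Grp → Set
Car G = AbelianGroup.Carrier G

Eq : (G : Grp) → Car G → Car G → Set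
Eq G = AbelianGroup._≈_ G

mul : (G : Grp) → ℕ → Car G → Car G
mul G zero x = AbelianGroup.ε G
mul G (suc n) x = AbelianGroup._∙_ G x (mul G n x)

TorsionFree : Grp → Set
TorsionFree G = ∀ (n : ℕ) (x : Car G) → Eq G (mul G (suc n) x) (AbelianGroup.ε G) → Eq G x (AbelianGroup.ε G)

InPn : (G : Grp) → ℕ → ℕ → Car G → Set
InPn G p n x = Σ (Car G) λ y → Eq G (mul G (p ^ n) y) x

InPω : (G : Grp) → ℕ → Car G → Set
InPω G p x = ∀ (n : ℕ) → InPn G p n x

CardPωLe : (G : Grp) → ℕ → Set → Set
CardPωLe G p K =
  Σ (Σ (Car G) (InPω G p) → K) λ h →
    (∀ (u v : Σ (Car G) (InPω G p)) → Eq G (Data.Product.proj₁ u) (Data.Product.proj₁ v) → h u ≡ h v)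
    × (∀ (u v : Σ (Car G) (InPω G p)) → h u ≡ h v → Eq G (Data.Product.proj₁ u) (Data.Product.proj₁ v))

Infinite : Set → Set
Infinite K = Σ (ℕ → K) λ e → ∀ m n → e m ≡ e n → m ≡ n

record IsEmb (M N : Grp) (f : Car M → Car N) : Set where
  field
    f-cong : ∀ {x y} → Eq M x y → Eq N (f x) (f y)
    f-hom  : ∀ x y → Eq N (f (AbelianGroup._∙_ M x y)) (AbelianGroup._∙_ N (f x) (f y))
    f-inj  : ∀ {x y} → Eq N (f x) (f y) → Eq M x y

PureImage : (M N : Grp) → (Car M → Car N) → Set
PureImage M N f = ∀ (n : ℕ) (y : Car N) (a : Car M) → Eq N (mul N n y) (f a) →
  Σ (Car M) λ b → Eq N (mul N n (f b)) (f a)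

IsTFEmb : (M N : Grp) → (Car M → Car N) → Set
IsTFEmb M N f = IsEmb M N f × PureImage M N f

ImageEq : (M N : Grp) → (Car M → Car N) → (Car M → Set) → (Car N → Set) → Set
ImageEq M N f S T =
  (∀ x → S x → T (f x)) × (∀ y → T y → Σ (Car M) λ x → S x × Eq N (f x) y)

SubsetEq : (M : Grp) → (Car M → Set) → (Car M → Set) → Set
SubsetEq M S T = (∀ x → S x → T x) × (∀ x → T x → S x)

-- membership in K_2(κ) (κ represented by the set K)
InK2 : ℕ → ℕ → Set → Grp → Set
InK2 p₁ p₂ K G = TorsionFree G × CardPωLe G p₁ K × CardPωLe G p₂ K

IsK2Emb : ℕ → ℕ → (M N : Grp) → (Car M → Car N) → Set
IsK2Emb p₁ p₂ M N f =
  IsEmb M N f × PureImage M N f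
  × ImageEq M N f (InPω M p₁) (InPω N p₁)
  × (SubsetEq M (InPω M p₂) (InPω M p₁) ⊎ ImageEq M N f (InPω M p₂) (InPω N p₂))

-- Galois types for an abstract class (InK, IsKEmb), over a set A
-- (given as the carrier of a group, included in N by an injective map).
record Triple (InK : Grp → Set) (A : Grp) : Set₁ where
  field
    N     : Grp
    N∈K   : InK N
    b     : Car N
    inc   : Car A → Car N
    inc-cong : ∀ {x y} → Eq A x y → Eq N (inc x) (inc y)
    inc-inj  : ∀ {x y} → Eq N (inc x) (inc y) → Eq A x y

module _ (InK : Grp → Set) (IsKEmb : (M N : Grp) → (Car M → Car N) → Set) (A : Grp) where
  open Triple

  Eat : Triple InK A → Triple InK A → Set₁
  Eat t₁ t₂ =
    Σ Grp λ M → InK M ×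
    Σ (Car (N t₁) → Car M) λ f₁ → IsKEmb (N t₁) M f₁ ×
    Σ (Car (N t₂) → Car M) λ f₂ → IsKEmb (N t₂) M f₂ ×
      (∀ a → Eq M (f₁ (inc t₁ a)) (f₂ (inc t₂ a)))
      × Eq M (f₁ (b t₁)) (f₂ (b t₂))

  SameGtp : Triple InK A → Triple InK A → Set₁
  SameGtp = TransClosure Eat

mkTriple : (InK : Grp → Set) (A H : Grp) → InK H → Car H → (ι : Car A → Car H) → IsEmb A H ι → Triple InK A
mkTriple InK A H H∈ a ι e = record
  { N = H ; N∈K = H∈ ; b = a ; inc = ι
  ; inc-cong = IsEmb.f-cong e ; inc-inj = IsEmb.f-inj e }

{-# OPTIONS --safe #-}
-- Forgetting the extra K₂ conditions turns a chain of K₂ amalgams into a chain of K_TF amalgams.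
-- Conversely, a K_TF amalgam is torsion-free and its embeddings are pure, so it transports, from one
-- triple to the other, which terms over G ∪ {a} have a common quotient (CommonRoot).  This data
-- identifies the pure hull of ι₁[G] ∪ {a₁} in H₁ with that of ι₂[G] ∪ {a₂} in H₂.  The hull embeds purely
-- into both Hᵢ and contains p₁^ω Hᵢ = ιᵢ[p₁^ω G] and p₂^ω Hᵢ ⊆ ιᵢ[G], so both embeddings are
-- K₂-embeddings and the hull links the two triples by two E_at steps.
module Submission where

open import Defs
open import Level using (0ℓ)
open import Data.Nat using (ℕ; zero; suc; _*_; _^_; pred)
open import Data.Nat.Properties using (*-comm)
open import Data.Nat.Primality using (Prime)
open import Data.Product using (Σ; _×_; _,_; proj₁; proj₂)
open import Data.Sum using (inj₂)
open import Function using (id; _∘_)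
open import Function.Bundles using (_⇔_; mk⇔)
open import Relation.Binary.PropositionalEquality as ≡ using (_≡_; _≢_)
open import Relation.Binary.Definitions using (Symmetric; _Respects_)
open import Relation.Binary.Construct.Closure.Transitive
  using (TransClosure; [_]; _∷_; symmetric)
open import Algebra.Bundles using (AbelianGroup; RawGroup)
open import Algebra.Morphism.Structures using (module GroupMorphisms)
import Algebra.Morphism.GroupMonomorphism as GroupMonomorphism
import Algebra.Properties.AbelianGroup as AbelianGroupProperties
import Algebra.Properties.CommutativeMonoid.Mult as CommutativeMonoidMult

module Multiples (G : Grp) where
  open AbelianGroup G
  open AbelianGroupProperties G using (inverseʳ-unique; x∙y⁻¹≈ε⇒x≈y)
  open CommutativeMonoidMult commutativeMonoid using (×-assocˡ; ×-distrib-+)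
    renaming (_×_ to _·_)
  open import Relation.Binary.Reasoning.Setoid setoid

  mul≡· : ∀ n x → mul G n x ≡ n · x
  mul≡· zero    x = ≡.refl
  mul≡· (suc n) x = ≡.cong (x ∙_) (mul≡· n x)

  mul-congʳ : ∀ n {x y} → x ≈ y → mul G n x ≈ mul G n y
  mul-congʳ zero    x≈y = refl
  mul-congʳ (suc n) x≈y = ∙-cong x≈y (mul-congʳ n x≈y)

  mul-ε : ∀ n → mul G n ε ≈ ε
  mul-ε zero    = refl
  mul-ε (suc n) = trans (identityˡ _) (mul-ε n)

  mul-∙ : ∀ n x y → mul G n (x ∙ y) ≈ mul G n x ∙ mul G n y
  mul-∙ n x y = begin
    mul G n (x ∙ y)           ≡⟨ mul≡· n (x ∙ y) ⟩
    n · (x ∙ y)               ≈⟨ ×-distrib-+ x y n ⟩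
    n · x ∙ n · y             ≡⟨ ≡.cong₂ _∙_ (mul≡· n x) (mul≡· n y) ⟨
    mul G n x ∙ mul G n y     ∎

  mul-assoc : ∀ m n x → mul G m (mul G n x) ≈ mul G (m * n) x
  mul-assoc m n x = begin
    mul G m (mul G n x)       ≡⟨ ≡.cong (mul G m) (mul≡· n x) ⟩
    mul G m (n · x)           ≡⟨ mul≡· m (n · x) ⟩
    m · (n · x)               ≈⟨ ×-assocˡ x m n ⟩
    (m * n) · x               ≡⟨ mul≡· (m * n) x ⟨
    mul G (m * n) x           ∎

  mul-⁻¹ : ∀ n x → mul G n (x ⁻¹) ≈ mul G n x ⁻¹
  mul-⁻¹ n x = inverseʳ-unique (mul G n x) (mul G n (x ⁻¹)) (begin
    mul G n x ∙ mul G n (x ⁻¹) ≈⟨ mul-∙ n x (x ⁻¹) ⟨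
    mul G n (x ∙ x ⁻¹)         ≈⟨ mul-congʳ n (inverseʳ x) ⟩
    mul G n ε                  ≈⟨ mul-ε n ⟩
    ε                          ∎)

  mul-injective : TorsionFree G → ∀ n {x y} → mul G (suc n) x ≈ mul G (suc n) y → x ≈ y
  mul-injective tf n {x} {y} nx≈ny = x∙y⁻¹≈ε⇒x≈y x y (tf n (x ∙ y ⁻¹) (begin
    mul G (suc n) (x ∙ y ⁻¹)                ≈⟨ mul-∙ (suc n) x (y ⁻¹) ⟩
    mul G (suc n) x ∙ mul G (suc n) (y ⁻¹)  ≈⟨ ∙-cong nx≈ny (mul-⁻¹ (suc n) y) ⟩
    mul G (suc n) y ∙ mul G (suc n) y ⁻¹    ≈⟨ inverseʳ _ ⟩
    ε                                       ∎))

data Term (A : Set) : Set where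
  var  : A → Term A
  pt   : Term A
  0ᵗ   : Term A
  _+ᵗ_ : Term A → Term A → Term A
  -ᵗ_  : Term A → Term A

_·ᵗ_ : {A : Set} → ℕ → Term A → Term A
zero  ·ᵗ t = 0ᵗ
suc k ·ᵗ t = t +ᵗ (k ·ᵗ t)

eval : (N : Grp) {A : Set} → (A → Car N) → Car N → Term A → Car N
eval N ι b (var a)  = ι a
eval N ι b pt       = b
eval N ι b 0ᵗ       = AbelianGroup.ε N
eval N ι b (s +ᵗ t) = AbelianGroup._∙_ N (eval N ι b s) (eval N ι b t)
eval N ι b (-ᵗ t)   = AbelianGroup._⁻¹ N (eval N ι b t)

eval-·ᵗ : (N : Grp) {A : Set} (ι : A → Car N) (b : Car N) →
  ∀ k t → eval N ι b (k ·ᵗ t) ≡ mul N k (eval N ι b t)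
eval-·ᵗ N ι b zero    t = ≡.refl
eval-·ᵗ N ι b (suc k) t = ≡.cong (AbelianGroup._∙_ N (eval N ι b t)) (eval-·ᵗ N ι b k t)

eval-cong : (N : Grp) {A : Set} {ι ι′ : A → Car N} {b b′ : Car N} →
  (∀ a → Eq N (ι a) (ι′ a)) → Eq N b b′ → ∀ t → Eq N (eval N ι b t) (eval N ι′ b′ t)
eval-cong N ι≈ι′ b≈b′ (var a)  = ι≈ι′ a
eval-cong N ι≈ι′ b≈b′ pt       = b≈b′
eval-cong N ι≈ι′ b≈b′ 0ᵗ       = AbelianGroup.refl N
eval-cong N ι≈ι′ b≈b′ (s +ᵗ t) = AbelianGroup.∙-cong N (eval-cong N ι≈ι′ b≈b′ s) (eval-cong N ι≈ι′ b≈b′ t)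
eval-cong N ι≈ι′ b≈b′ (-ᵗ t)   = AbelianGroup.⁻¹-cong N (eval-cong N ι≈ι′ b≈b′ t)

-- The divisor is 1 + k, so that it is never 0.
IsRoot : (N : Grp) {A : Set} → (A → Car N) → Car N → ℕ → Term A → Car N → Set
IsRoot N ι b k s x = Eq N (mul N (suc k) x) (eval N ι b s)

-- Taking s = t gives the divisibilities and n = m = 0 the equations satisfied by ι[A] ∪ {b} in N.
CommonRoot : (N : Grp) {A : Set} → (A → Car N) → Car N → ℕ → Term A → ℕ → Term A → Set
CommonRoot N ι b n s m t = Σ (Car N) λ y → IsRoot N ι b n s y × IsRoot N ι b m t y

CommonRoot-cong : (N : Grp) {A : Set} {ι ι′ : A → Car N} {b b′ : Car N} →
  (∀ a → Eq N (ι a) (ι′ a)) → Eq N b b′ →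
  ∀ {n s m t} → CommonRoot N ι b n s m t → CommonRoot N ι′ b′ n s m t
CommonRoot-cong N ι≈ι′ b≈b′ {s = s} {t = t} (y , y-root-s , y-root-t) =
  y , trans y-root-s (eval-cong N ι≈ι′ b≈b′ s) , trans y-root-t (eval-cong N ι≈ι′ b≈b′ t)
  where open AbelianGroup N

module Roots (N : Grp) {A : Set} (ι : A → Car N) (b : Car N) where
  open AbelianGroup N
  open Multiples N
  open import Relation.Binary.Reasoning.Setoid setoid

  IsRoot-var : ∀ a → IsRoot N ι b 0 (var a) (ι a)
  IsRoot-var a = identityʳ (ι a)

  IsRoot-pt : IsRoot N ι b 0 pt b
  IsRoot-pt = identityʳ b

  IsRoot-ε : IsRoot N ι b 0 0ᵗ ε
  IsRoot-ε = identityʳ ε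

  IsRoot-⁻¹ : ∀ k s {x} → IsRoot N ι b k s x → IsRoot N ι b k (-ᵗ s) (x ⁻¹)
  IsRoot-⁻¹ k s {x} x-root = trans (mul-⁻¹ (suc k) x) (⁻¹-cong x-root)

  IsRoot-∙ : ∀ k s l t {x y} → IsRoot N ι b k s x → IsRoot N ι b l t y →
    IsRoot N ι b (pred (suc k * suc l)) ((suc l ·ᵗ s) +ᵗ (suc k ·ᵗ t)) (x ∙ y)
  IsRoot-∙ k s l t {x} {y} x-root y-root = begin
    mul N (suc k * suc l) (x ∙ y)
      ≈⟨ mul-∙ (suc k * suc l) x y ⟩
    mul N (suc k * suc l) x ∙ mul N (suc k * suc l) y
      ≡⟨ ≡.cong (λ j → mul N j x ∙ mul N (suc k * suc l) y) (*-comm (suc k) (suc l)) ⟩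
    mul N (suc l * suc k) x ∙ mul N (suc k * suc l) y
      ≈⟨ ∙-cong (mul-assoc (suc l) (suc k) x) (mul-assoc (suc k) (suc l) y) ⟨
    mul N (suc l) (mul N (suc k) x) ∙ mul N (suc k) (mul N (suc l) y)
      ≈⟨ ∙-cong (mul-congʳ (suc l) x-root) (mul-congʳ (suc k) y-root) ⟩
    mul N (suc l) ⟦ s ⟧ ∙ mul N (suc k) ⟦ t ⟧
      ≡⟨ ≡.cong₂ _∙_ (eval-·ᵗ N ι b (suc l) s) (eval-·ᵗ N ι b (suc k) t) ⟨
    ⟦ (suc l ·ᵗ s) +ᵗ (suc k ·ᵗ t) ⟧
      ∎
    where ⟦_⟧ = eval N ι b

  IsRoot-divisor : ∀ n k s {y x} → Eq N (mul N (suc n) y) x → IsRoot N ι b k s x →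
    IsRoot N ι b (pred (suc k * suc n)) s y
  IsRoot-divisor n k s {y} ny≈x x-root =
    trans (sym (mul-assoc (suc k) (suc n) y)) (trans (mul-congʳ (suc k) ny≈x) x-root)

  IsRoot-unique : TorsionFree N → ∀ {k s x y} → IsRoot N ι b k s x → IsRoot N ι b k s y → x ≈ y
  IsRoot-unique tf {k} x-root y-root = mul-injective tf k (trans x-root (sym y-root))

  ≈⇒CommonRoot : ∀ n s m t {x y} → IsRoot N ι b n s x → IsRoot N ι b m t y → x ≈ y →
    CommonRoot N ι b n s m t
  ≈⇒CommonRoot n s m t x-root y-root x≈y = _ , x-root , trans (mul-congʳ (suc m) x≈y) y-root

  CommonRoot⇒≈ : TorsionFree N → ∀ n s m t {x y} → IsRoot N ι b n s x → IsRoot N ι b m t y →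
    CommonRoot N ι b n s m t → x ≈ y
  CommonRoot⇒≈ tf n s m t x-root y-root (z , z-root-s , z-root-t) =
    trans (IsRoot-unique tf {n} {s} x-root z-root-s) (IsRoot-unique tf {m} {t} z-root-t y-root)

ImageCovers : (N : Grp) {X : Set} → (X → Car N) → (Car N → Set) → Set
ImageCovers N {X} f P = ∀ y → P y → Σ X λ x → Eq N (f x) y

ImageCovers-∘ : (N : Grp) {X Y : Set} {f : Y → Car N} {P : Car N → Set} (g : X → Y) →
  ImageCovers N (f ∘ g) P → ImageCovers N f P
ImageCovers-∘ N g covers y y∈P = g (proj₁ (covers y y∈P)) , proj₂ (covers y y∈P)

ImageEq⇒ImageCovers : (M N : Grp) {f : Car M → Car N} {S : Car M → Set} {T : Car N → Set} →
  ImageEq M N f S T → ImageCovers N f T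
ImageEq⇒ImageCovers M N (_ , T⊆fS) y y∈T = proj₁ (T⊆fS y y∈T) , proj₂ (proj₂ (T⊆fS y y∈T))

module Embedding {M N : Grp} {f : Car M → Car N} (f-emb : IsEmb M N f) where
  open IsEmb f-emb
  private module M = AbelianGroup M
  open AbelianGroup N
  open AbelianGroupProperties N using (identityˡ-unique; inverseʳ-unique)
  open Multiples N using (mul-congʳ; mul-injective)

  f-ε : f M.ε ≈ ε
  f-ε = identityˡ-unique (f M.ε) (f M.ε) (trans (sym (f-hom M.ε M.ε)) (f-cong (M.identityˡ M.ε)))

  f-⁻¹ : ∀ x → f (x M.⁻¹) ≈ f x ⁻¹
  f-⁻¹ x = inverseʳ-unique (f x) (f (x M.⁻¹))
    (trans (sym (f-hom x (x M.⁻¹))) (trans (f-cong (M.inverseʳ x)) f-ε))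

  f-mul : ∀ n x → f (mul M n x) ≈ mul N n (f x)
  f-mul zero    x = f-ε
  f-mul (suc n) x = trans (f-hom x (mul M n x)) (∙-congˡ (f-mul n x))

  f-eval : ∀ {A} (ι : A → Car M) b t → f (eval M ι b t) ≈ eval N (f ∘ ι) (f b) t
  f-eval ι b (var a)  = refl
  f-eval ι b pt       = refl
  f-eval ι b 0ᵗ       = f-ε
  f-eval ι b (s +ᵗ t) = trans (f-hom _ _) (∙-cong (f-eval ι b s) (f-eval ι b t))
  f-eval ι b (-ᵗ t)   = trans (f-⁻¹ _) (⁻¹-cong (f-eval ι b t))

  InPω-image : ∀ p {x} → InPω M p x → InPω N p (f x)
  InPω-image p x∈ n = f (proj₁ (x∈ n)) , trans (sym (f-mul (p ^ n) _)) (f-cong (proj₂ (x∈ n)))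

  TorsionFree-reflect : TorsionFree N → TorsionFree M
  TorsionFree-reflect tf n x nx≈ε = f-inj (trans fx≈ε (sym f-ε))
    where fx≈ε = tf n (f x) (trans (sym (f-mul (suc n) x)) (trans (f-cong nx≈ε) f-ε))

  CardPωLe-reflect : ∀ {p κ} → CardPωLe N p κ → CardPωLe M p κ
  CardPωLe-reflect {p} (h , h-cong , h-inj) =
    (λ u → h (f (proj₁ u) , InPω-image p (proj₂ u))) ,
    (λ u v u≈v → h-cong _ _ (f-cong u≈v)) ,
    (λ u v hu≡hv → f-inj (h-inj _ _ hu≡hv))

  CommonRoot-image : ∀ {A} {ι : A → Car M} {b n s m t} →
    CommonRoot M ι b n s m t → CommonRoot N (f ∘ ι) (f b) n s m t
  CommonRoot-image {ι = ι} {b} {n} {s} {m} {t} (y , y-root-s , y-root-t) =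
    f y , root (suc n) s y-root-s , root (suc m) t y-root-t
    where
    root : ∀ j u → Eq M (mul M j y) (eval M ι b u) → mul N j (f y) ≈ eval N (f ∘ ι) (f b) u
    root j u r = trans (sym (f-mul j y)) (trans (f-cong r) (f-eval ι b u))

  module _ (f-pure : PureImage M N f) where

    InPω-preimage : ∀ p {x} → InPω N p (f x) → InPω M p x
    InPω-preimage p {x} fx∈ n = proj₁ root , f-inj (trans (f-mul (p ^ n) _) (proj₂ root))
      where root = f-pure (p ^ n) (proj₁ (fx∈ n)) x (proj₂ (fx∈ n))

    ImageEq-InPω : ∀ p → ImageCovers N f (InPω N p) → ImageEq M N f (InPω M p) (InPω N p)
    ImageEq-InPω p covers = (λ _ → InPω-image p) , λ y y∈ →
      let (x , fx≈y) = covers y y∈ in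
      x , InPω-preimage p (λ n → proj₁ (y∈ n) , trans (proj₂ (y∈ n)) (sym fx≈y)) , fx≈y

    -- Purity yields a root c in M of s; torsion-freeness of N forces f c to be the given common root.
    CommonRoot-preimage : TorsionFree N → ∀ {A} {ι : A → Car M} {b n s m t} →
      CommonRoot N (f ∘ ι) (f b) n s m t → CommonRoot M ι b n s m t
    CommonRoot-preimage tf {ι = ι} {b} {n} {s} {m} {t} (y , y-root-s , y-root-t) =
      c , f-inj (trans (f-mul (suc n) c) fc-root-s) ,
          f-inj (trans (f-mul (suc m) c) (trans (mul-congʳ (suc m) fc≈y) (trans y-root-t (sym (f-eval ι b t)))))
      where
      y-root-fs = trans y-root-s (sym (f-eval ι b s))
      c = proj₁ (f-pure (suc n) y (eval M ι b s) y-root-fs)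
      fc-root-s = proj₂ (f-pure (suc n) y (eval M ι b s) y-root-fs)
      fc≈y = mul-injective tf n (trans fc-root-s (sym y-root-fs))

Respects-TransClosure : ∀ {a ℓ p} {X : Set a} {R : X → X → Set ℓ} {P : X → Set p} →
  P Respects R → P Respects TransClosure R
Respects-TransClosure P-resp [ xRy ]      = P-resp xRy
Respects-TransClosure P-resp (xRy ∷ yR⁺z) = Respects-TransClosure P-resp yR⁺z ∘ P-resp xRy

module _ {InK : Grp → Set} {IsKEmb : (M N : Grp) → (Car M → Car N) → Set} {A : Grp} where

  Eat-sym : Symmetric (Eat InK IsKEmb A)
  Eat-sym (M , M∈ , f₁ , f₁-emb , f₂ , f₂-emb , agree , same-b) =
    M , M∈ , f₂ , f₂-emb , f₁ , f₁-emb , (λ a → sym (agree a)) , sym same-b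
    where open AbelianGroup M

  SameGtp-sym : Symmetric (SameGtp InK IsKEmb A)
  SameGtp-sym = symmetric _ (λ {t} {t′} → Eat-sym {t} {t′})

  module _ {InK′ : Grp → Set} {IsKEmb′ : (M N : Grp) → (Car M → Car N) → Set}
    (InK⇒InK′ : ∀ {N} → InK N → InK′ N) (IsKEmb⇒IsKEmb′ : ∀ {M N f} → IsKEmb M N f → IsKEmb′ M N f)
    where

    Triple-map : Triple InK A → Triple InK′ A
    Triple-map t = record
      { N = N ; N∈K = InK⇒InK′ N∈K ; b = b ; inc = inc ; inc-cong = inc-cong ; inc-inj = inc-inj }
      where open Triple t

    Eat-map : ∀ {t t′} → Eat InK IsKEmb A t t′ → Eat InK′ IsKEmb′ A (Triple-map t) (Triple-map t′)
    Eat-map (M , M∈ , f₁ , f₁-emb , f₂ , f₂-emb , agree) =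
      M , InK⇒InK′ M∈ , f₁ , IsKEmb⇒IsKEmb′ f₁-emb , f₂ , IsKEmb⇒IsKEmb′ f₂-emb , agree

    SameGtp-map : ∀ {t t′} → SameGtp InK IsKEmb A t t′ → SameGtp InK′ IsKEmb′ A (Triple-map t) (Triple-map t′)
    SameGtp-map {t} {t′} [ t~t′ ]         = [ Eat-map {t} {t′} t~t′ ]
    SameGtp-map {t} (_∷_ {y = t′} t~t′ t′~⁺t″) = Eat-map {t} {t′} t~t′ ∷ SameGtp-map t′~⁺t″

CommonRootIn : {InK : Grp → Set} {A : Grp} → Triple InK A → ℕ → Term (Car A) → ℕ → Term (Car A) → Set
CommonRootIn t = CommonRoot (Triple.N t) (Triple.inc t) (Triple.b t)

CommonRootIn-respects-SameGtp : {A : Grp} → ∀ n s m t →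
  (λ τ → CommonRootIn τ n s m t) Respects SameGtp TorsionFree IsTFEmb A
CommonRootIn-respects-SameGtp {A} n s m t = Respects-TransClosure (λ {x} {y} → respects-Eat {x} {y})
  where
  respects-Eat : (λ τ → CommonRootIn τ n s m t) Respects Eat TorsionFree IsTFEmb A
  respects-Eat (M , M-tf , f₁ , (f₁-emb , _) , f₂ , (f₂-emb , f₂-pure) , agree , same-b) =
    Embedding.CommonRoot-preimage f₂-emb f₂-pure M-tf {n = n} {s} {m} {t}
    ∘ CommonRoot-cong M agree same-b {n} {s} {m} {t}
    ∘ Embedding.CommonRoot-image f₁-emb {n = n} {s} {m} {t}

-- The pure hull of ι₁[A] ∪ {a₁} in H₁, each element paired with its counterpart in the pure hull of
-- ι₂[A] ∪ {a₂} in H₂: an element of either hull is the quotient of a term by a positive integer.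
module Hull {A : Set} {H₁ H₂ : Grp} (tf₁ : TorsionFree H₁) (tf₂ : TorsionFree H₂)
  {ι₁ : A → Car H₁} {ι₂ : A → Car H₂} {a₁ : Car H₁} {a₂ : Car H₂}
  (root⇒ : ∀ n s m t → CommonRoot H₁ ι₁ a₁ n s m t → CommonRoot H₂ ι₂ a₂ n s m t)
  (root⇐ : ∀ n s m t → CommonRoot H₂ ι₂ a₂ n s m t → CommonRoot H₁ ι₁ a₁ n s m t)
  where
  private
    module H₁ = AbelianGroup H₁
    module H₂ = AbelianGroup H₂
    module R₁ = Roots H₁ ι₁ a₁
    module R₂ = Roots H₂ ι₂ a₂

  record Elem : Set where
    constructor elem
    field
      k  : ℕ
      s  : Term A
      π₁ : Car H₁
      π₂ : Car H₂
      π₁-root : IsRoot H₁ ι₁ a₁ k s π₁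
      π₂-root : IsRoot H₂ ι₂ a₂ k s π₂
  open Elem public using (π₁; π₂)
  open Elem

  _+_ : Elem → Elem → Elem
  elem k s x₁ x₂ x₁-root x₂-root + elem l t y₁ y₂ y₁-root y₂-root =
    elem (pred (suc k * suc l)) ((suc l ·ᵗ s) +ᵗ (suc k ·ᵗ t)) (x₁ H₁.∙ y₁) (x₂ H₂.∙ y₂)
      (R₁.IsRoot-∙ k s l t x₁-root y₁-root) (R₂.IsRoot-∙ k s l t x₂-root y₂-root)

  0ᴱ : Elem
  0ᴱ = elem 0 0ᵗ H₁.ε H₂.ε R₁.IsRoot-ε R₂.IsRoot-ε

  -_ : Elem → Elem
  - elem k s x₁ x₂ x₁-root x₂-root =
    elem k (-ᵗ s) (x₁ H₁.⁻¹) (x₂ H₂.⁻¹) (R₁.IsRoot-⁻¹ k s x₁-root) (R₂.IsRoot-⁻¹ k s x₂-root)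

  inj : A → Elem
  inj a = elem 0 (var a) (ι₁ a) (ι₂ a) (R₁.IsRoot-var a) (R₂.IsRoot-var a)

  point : Elem
  point = elem 0 pt a₁ a₂ R₁.IsRoot-pt R₂.IsRoot-pt

  rawHull : RawGroup 0ℓ 0ℓ
  rawHull = record
    { Carrier = Elem ; _≈_ = λ x y → π₁ x H₁.≈ π₁ y ; _∙_ = _+_ ; ε = 0ᴱ ; _⁻¹ = -_ }

  π₁-isGroupMonomorphism : GroupMorphisms.IsGroupMonomorphism rawHull H₁.rawGroup π₁
  π₁-isGroupMonomorphism = record
    { isGroupHomomorphism = record
      { isMonoidHomomorphism = record
        { isMagmaHomomorphism = record
          { isRelHomomorphism = record { cong = id }
          ; homo = λ _ _ → H₁.refl }
        ; ε-homo = H₁.refl }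
      ; ⁻¹-homo = λ _ → H₁.refl }
    ; injective = id }

  Hull : Grp
  Hull = record
    { RawGroup rawHull
    ; isAbelianGroup = GroupMonomorphism.isAbelianGroup π₁-isGroupMonomorphism H₁.isAbelianGroup }

  π₁-IsEmb : IsEmb Hull H₁ π₁
  π₁-IsEmb = record { f-cong = id ; f-hom = λ _ _ → H₁.refl ; f-inj = id }

  π₂-cong : ∀ {x y} → π₁ x H₁.≈ π₁ y → π₂ x H₂.≈ π₂ y
  π₂-cong {elem k s _ _ x₁-root x₂-root} {elem l t _ _ y₁-root y₂-root} x₁≈y₁ =
    R₂.CommonRoot⇒≈ tf₂ k s l t x₂-root y₂-root
      (root⇒ k s l t (R₁.≈⇒CommonRoot k s l t x₁-root y₁-root x₁≈y₁))

  π₂-injective : ∀ {x y} → π₂ x H₂.≈ π₂ y → π₁ x H₁.≈ π₁ y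
  π₂-injective {elem k s _ _ x₁-root x₂-root} {elem l t _ _ y₁-root y₂-root} x₂≈y₂ =
    R₁.CommonRoot⇒≈ tf₁ k s l t x₁-root y₁-root
      (root⇐ k s l t (R₂.≈⇒CommonRoot k s l t x₂-root y₂-root x₂≈y₂))

  π₂-IsEmb : IsEmb Hull H₂ π₂
  π₂-IsEmb = record
    { f-cong = λ {x} {y} → π₂-cong {x} {y} ; f-hom = λ _ _ → H₂.refl ; f-inj = λ {x} {y} → π₂-injective {x} {y} }

  fromRoot₁ : ∀ k s y → IsRoot H₁ ι₁ a₁ k s y → Elem
  fromRoot₁ k s y y-root = elem k s y (proj₁ z) y-root (proj₁ (proj₂ z))
    where z = root⇒ k s k s (y , y-root , y-root)

  fromRoot₂ : ∀ k s y → IsRoot H₂ ι₂ a₂ k s y → Elem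
  fromRoot₂ k s y y-root = elem k s (proj₁ z) y (proj₁ (proj₂ z)) y-root
    where z = root⇐ k s k s (y , y-root , y-root)

  π₁-pure : PureImage Hull H₁ π₁
  π₁-pure zero    y x 0≈x = x , 0≈x
  π₁-pure (suc n) y (elem k s _ _ x₁-root _) ny≈x₁ =
    fromRoot₁ (pred (suc k * suc n)) s y (R₁.IsRoot-divisor n k s ny≈x₁ x₁-root) , ny≈x₁

  π₂-pure : PureImage Hull H₂ π₂
  π₂-pure zero    y x 0≈x = x , 0≈x
  π₂-pure (suc n) y (elem k s _ _ _ x₂-root) ny≈x₂ =
    fromRoot₂ (pred (suc k * suc n)) s y (R₂.IsRoot-divisor n k s ny≈x₂ x₂-root) , ny≈x₂

module _ {p₁ p₂ : ℕ} where

  pureEmb⇒IsK2Emb : ∀ {M N f} → IsEmb M N f → PureImage M N f →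
    ImageCovers N f (InPω N p₁) → ImageCovers N f (InPω N p₂) → IsK2Emb p₁ p₂ M N f
  pureEmb⇒IsK2Emb f-emb f-pure p₁ω⊆f[M] p₂ω⊆f[M] =
    f-emb , f-pure , ImageEq-InPω f-pure p₁ p₁ω⊆f[M] , inj₂ (ImageEq-InPω f-pure p₂ p₂ω⊆f[M])
    where open Embedding f-emb

  id-IsK2Emb : (H : Grp) → IsK2Emb p₁ p₂ H H id
  id-IsK2Emb H = pureEmb⇒IsK2Emb id-IsEmb (λ _ y _ ny≈a → y , ny≈a) (λ y _ → y , refl) (λ y _ → y , refl)
    where
    open AbelianGroup H using (refl)
    id-IsEmb : IsEmb H H id
    id-IsEmb = record { f-cong = id ; f-hom = λ _ _ → refl ; f-inj = id }

  InK2-reflect : ∀ {κ M N f} → IsEmb M N f → InK2 p₁ p₂ κ N → InK2 p₁ p₂ κ M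
  InK2-reflect f-emb (tf , card₁ , card₂) =
    TorsionFree-reflect tf , CardPωLe-reflect card₁ , CardPωLe-reflect card₂
    where open Embedding f-emb

  module _ {κ : Set} {G H₁ H₂ : Grp} (H₁∈ : InK2 p₁ p₂ κ H₁) (H₂∈ : InK2 p₁ p₂ κ H₂)
    {ι₁ : Car G → Car H₁} (ι₁-emb : IsK2Emb p₁ p₂ G H₁ ι₁)
    {ι₂ : Car G → Car H₂} (ι₂-emb : IsK2Emb p₁ p₂ G H₂ ι₂)
    (a₁ : Car H₁) (a₂ : Car H₂)
    (p₂ω₁⊆G : ImageCovers H₁ ι₁ (InPω H₁ p₂)) (p₂ω₂⊆G : ImageCovers H₂ ι₂ (InPω H₂ p₂))
    (root⇒ : ∀ n s m t → CommonRoot H₁ ι₁ a₁ n s m t → CommonRoot H₂ ι₂ a₂ n s m t)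
    (root⇐ : ∀ n s m t → CommonRoot H₂ ι₂ a₂ n s m t → CommonRoot H₁ ι₁ a₁ n s m t)
    where
    open Hull {H₁ = H₁} {H₂ = H₂} (proj₁ H₁∈) (proj₁ H₂∈) root⇒ root⇐

    hullTriple : Triple (InK2 p₁ p₂ κ) G
    hullTriple = record
      { N = Hull ; N∈K = InK2-reflect π₁-IsEmb H₁∈ ; b = point ; inc = inj
      ; inc-cong = IsEmb.f-cong (proj₁ ι₁-emb) ; inc-inj = IsEmb.f-inj (proj₁ ι₁-emb) }

    π₁-IsK2Emb : IsK2Emb p₁ p₂ Hull H₁ π₁
    π₁-IsK2Emb = pureEmb⇒IsK2Emb π₁-IsEmb π₁-pure
      (ImageCovers-∘ H₁ inj (ImageEq⇒ImageCovers G H₁ (proj₁ (proj₂ (proj₂ ι₁-emb)))))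
      (ImageCovers-∘ H₁ inj p₂ω₁⊆G)

    π₂-IsK2Emb : IsK2Emb p₁ p₂ Hull H₂ π₂
    π₂-IsK2Emb = pureEmb⇒IsK2Emb π₂-IsEmb π₂-pure
      (ImageCovers-∘ H₂ inj (ImageEq⇒ImageCovers G H₂ (proj₁ (proj₂ (proj₂ ι₂-emb)))))
      (ImageCovers-∘ H₂ inj p₂ω₂⊆G)

    SameGtpK2-via-hull : SameGtp (InK2 p₁ p₂ κ) (IsK2Emb p₁ p₂) G
      (mkTriple (InK2 p₁ p₂ κ) G H₁ H₁∈ a₁ ι₁ (proj₁ ι₁-emb))
      (mkTriple (InK2 p₁ p₂ κ) G H₂ H₂∈ a₂ ι₂ (proj₁ ι₂-emb))
    SameGtpK2-via-hull =
      _∷_ {y = hullTriple}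
        (H₁ , H₁∈ , id , id-IsK2Emb H₁ , π₁ , π₁-IsK2Emb , (λ _ → H₁.refl) , H₁.refl)
        [ H₂ , H₂∈ , π₂ , π₂-IsK2Emb , id , id-IsK2Emb H₂ , (λ _ → H₂.refl) , H₂.refl ]
      where
      module H₁ = AbelianGroup H₁
      module H₂ = AbelianGroup H₂

lemma4p21 : (p₁ p₂ : ℕ) → Prime p₁ → Prime p₂ → p₁ ≢ p₂ →
    (κ : Set) → Infinite κ →
    (G H₁ H₂ : Grp) →
    (G∈ : InK2 p₁ p₂ κ G) (H₁∈ : InK2 p₁ p₂ κ H₁) (H₂∈ : InK2 p₁ p₂ κ H₂) →
    (ι₁ : Car G → Car H₁) → (e₁ : IsK2Emb p₁ p₂ G H₁ ι₁) →
    (ι₂ : Car G → Car H₂) → (e₂ : IsK2Emb p₁ p₂ G H₂ ι₂) →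
    (a₁ : Car H₁) (a₂ : Car H₂) →
    (∀ h → InPω H₁ p₂ h → Σ (Car G) λ g → Eq H₁ (ι₁ g) h) →
    (∀ h → InPω H₂ p₂ h → Σ (Car G) λ g → Eq H₂ (ι₂ g) h) →
    SameGtp TorsionFree IsTFEmb G
      (mkTriple TorsionFree G H₁ (proj₁ H₁∈) a₁ ι₁ (proj₁ e₁))
      (mkTriple TorsionFree G H₂ (proj₁ H₂∈) a₂ ι₂ (proj₁ e₂))
    ⇔
    SameGtp (InK2 p₁ p₂ κ) (IsK2Emb p₁ p₂) G
      (mkTriple (InK2 p₁ p₂ κ) G H₁ H₁∈ a₁ ι₁ (proj₁ e₁))
      (mkTriple (InK2 p₁ p₂ κ) G H₂ H₂∈ a₂ ι₂ (proj₁ e₂))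
lemma4p21 p₁ p₂ _ _ _ κ _ G H₁ H₂ _ H₁∈ H₂∈ ι₁ e₁ ι₂ e₂ a₁ a₂ p₂ω₁⊆G p₂ω₂⊆G = mk⇔
  (λ same → SameGtpK2-via-hull H₁∈ H₂∈ e₁ e₂ a₁ a₂ p₂ω₁⊆G p₂ω₂⊆G
     (λ n s m t → CommonRootIn-respects-SameGtp n s m t same)
     (λ n s m t → CommonRootIn-respects-SameGtp n s m t (SameGtp-sym {InK = TorsionFree} {IsKEmb = IsTFEmb} same)))
  (SameGtp-map proj₁ (λ (f-emb , f-pure , _) → f-emb , f-pure))
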